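{- Let $p$ be a prime and let $(\Omega,S)$ be a coherent configuration with fibers $\Omega_1,\dots,\Omega_m$ such that $(\Omega_i,S_i)\simeq C_p\wr C_p$ for each $i$ and $n_s=p$ for each $s\in\bigcup_{i\ne j}S_{ij}$. Let $R$ be the set of regular elements of $S$, $N:=\bigcup_{i=1}^mS_i\cup(S\setminus R)$, and suppose $S=N$. Let $i,j,k$ be distinct and $s_1\in S_{ij}$, $s_2\in S_{jk}$, $s_3\in S_{ik}$. Then $\sigma_{s_1}\sigma_{s_2}=\sigma_{s_3}\left(\sum_{t\in\mathbf{O}_\theta(S_k)}a_t\sigma_t\right)$ for some nonnegative integers $a_t$ with $\sum_{t\in\mathbf{O}_\theta(S_k)}a_t=p$, $\sum_{t\in\mathbf{O}_\theta(S_k)}a_t^2=2p-1$, and $\sum_{t\in\mathbf{O}_\theta(S_k)}a_ta_{tu}=p-1$ for each $u\in\mathbf{O}_\theta(S_k)\setminus\{1_{\Omega_k}\}$.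
   Context: A coherent configuration is a pair $(\Omega,S)$ of a finite set $\Omega$ and a partition $S$ of $\Omega\times\Omega$ such that $1_\Omega$ is a union of elements of $S$, $s^\ast:=\{(\beta,\alpha)\mid(\alpha,\beta)\in s\}\in S$ for $s\in S$, and $\sigma_s\sigma_t=\sum_{u\in S}c_{st}^u\sigma_u$ with nonnegative integers $c_{st}^u$, where $\sigma_u$ is the $\Omega\times\Omega$ adjacency matrix of $u$. Fibers are the sets $\Delta$ with $1_\Delta\in S$; they partition $\Omega$. $S_{ij}:=\{s\in S\mid s\subseteq\Omega_i\times\Omega_j\}$, $S_i:=S_{ii}$. For $s\in S_{ij}$, $n_s:=|\{\beta\mid(\alpha,\beta)\in s\}|$ for any $\alpha\in\Omega_i$. $\mathbf{O}_\theta(S_k):=\{t\in S_k\mid n_t=1\}$; it is a group of order $p$ under relational composition, and for $t,u\in\mathbf{O}_\theta(S_k)$, $tu$ denotes their composition (the unique element of the complex product). The complex product of $T,U\subseteq S$ is $TU:=\{s\mid c_{tu}^s>0$ for some $t\in T,u\in U\}$, singletons written without braces. An element $s\in S$ is regular if $ss^\ast s=\{s\}$. $C_p\wr C_p$ is the association scheme on $\mathbb{Z}_p\times\mathbb{Z}_p$ with relations $\{((x,y),(x+a,y))\}$ ($a\in\mathbb{Z}_p$) and $\{((x_1,y),(x_2,y+b))\}$ ($b\ne0$). -}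

module Defs where

open import Data.Nat using (ℕ; zero; suc; _+_; _*_; _<_; _%_)
open import Data.Fin using (Fin; toℕ; _≟_)
open import Data.Product using (Σ; ∃; _×_; _,_)
open import Data.Sum using (_⊎_)
open import Relation.Nullary using (¬_; yes; no)
open import Relation.Binary.PropositionalEquality using (_≡_; _≢_)

sumF : ∀ {n} → (Fin n → ℕ) → ℕ
sumF {zero}  f = 0
sumF {suc n} f = f Fin.zero + sumF (λ i → f (Fin.suc i))

[_≟ᶜ_] : ∀ {r} → Fin r → Fin r → ℕ
[ s ≟ᶜ t ] with s ≟ t
... | yes _ = 1
... | no  _ = 0

Mat : ℕ → Set
Mat n = Fin n → Fin n → ℕ

_⊗_ : ∀ {n} → Mat n → Mat n → Mat n
(A ⊗ B) α β = sumF (λ γ → A α γ * B γ β)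

-- A partition S of Ω × Ω (Ω = Fin n) into r classes is given by a
-- colouring col : Ω → Ω → Fin r (the class of (α,β) is col α β).

module _ {n r : ℕ} (col : Fin n → Fin n → Fin r) where

  σ : Fin r → Mat n
  σ s α β = [ col α β ≟ᶜ s ]

  pathCount : Fin r → Fin r → Fin n → Fin n → ℕ
  pathCount s t = σ s ⊗ σ t

  outDeg : Fin r → Fin n → ℕ
  outDeg s α = sumF (λ β → σ s α β)

record CoherentConfiguration (n r : ℕ) : Set where
  field
    col       : Fin n → Fin n → Fin r
    nonempty  : ∀ s → Σ (Fin n) λ α → Σ (Fin n) λ β → col α β ≡ s
    -- 1_Ω is a union of classes
    diagonal  : ∀ α β γ → col α α ≡ col β γ → β ≡ γ
    -- s* ∈ S for s ∈ S
    transpose : ∀ α β γ δ → col α β ≡ col γ δ → col β α ≡ col δ γ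
    -- σ_s σ_t is a linear combination of the σ_u: its entries are
    -- constant on every class u (the constant being c_{st}^u)
    coherent  : ∀ s t α β γ δ → col α β ≡ col γ δ →
                pathCount col s t α β ≡ pathCount col s t γ δ

module CC {n r : ℕ} (X : CoherentConfiguration n r) where
  open CoherentConfiguration X public

  -- Fibers are indexed by their diagonal colour i (1_{Ω_i} = class i)
  IsFiber : Fin r → Set
  IsFiber i = Σ (Fin n) λ α → col α α ≡ i

  InS : Fin r → Fin r → Fin r → Set
  InS s i j = ∀ α β → col α β ≡ s → (col α α ≡ i) × (col β β ≡ j)

  Valency : Fin r → ℕ → Set
  Valency s v = ∀ α β → col α β ≡ s → outDeg col s α ≡ v

  Sub : Set₁
  Sub = Fin r → Set

  ⟦_⟧ : Fin r → Sub
  ⟦ s ⟧ t = t ≡ s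

  StarOf : Fin r → Sub
  StarOf s t = ∀ α β → col α β ≡ s → col β α ≡ t

  -- complex product: u ∈ TU iff c_{tv}^u > 0 for some t ∈ T, v ∈ U
  -- (c_{tv}^u > 0 iff (σ_t σ_v)_{αβ} > 0 for some (α,β) ∈ u)
  _⋆_ : Sub → Sub → Sub
  (T ⋆ U) u = Σ (Fin r) λ t → Σ (Fin r) λ v → T t × U v ×
              (Σ (Fin n) λ α → Σ (Fin n) λ β → (col α β ≡ u) × (0 < pathCount col t v α β))

  Regular : Fin r → Set
  Regular s = ∀ u → (((⟦ s ⟧ ⋆ StarOf s) ⋆ ⟦ s ⟧) u → u ≡ s) × (u ≡ s → ((⟦ s ⟧ ⋆ StarOf s) ⋆ ⟦ s ⟧) u)

  InO : Fin r → Fin r → Set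
  InO k t = InS t k k × Valency t 1

  IsComp : Fin r → Fin r → Fin r → Set
  IsComp t u v = ∀ α γ β → col α γ ≡ t → col γ β ≡ u → col α β ≡ v

modN : ℕ → ℕ → ℕ
modN zero    a = a
modN (suc q) a = a % suc q

-- ((x₁,y₁),(x₂,y₂)) and ((x₁',y₁'),(x₂',y₂')) lie in the same relation
-- of C_p ≀ C_p: either both have y₂ = y₁ with the same a = x₂ - x₁, or
-- both have y₂ ≠ y₁ with the same b = y₂ - y₁ (mod p).
WrSame : (p : ℕ) → (Fin p × Fin p) → (Fin p × Fin p) → (Fin p × Fin p) → (Fin p × Fin p) → Set
WrSame p (x₁ , y₁) (x₂ , y₂) (x₁' , y₁') (x₂' , y₂') =
  ((y₁ ≡ y₂) × (y₁' ≡ y₂') × (modN p (toℕ x₂ + toℕ x₁') ≡ modN p (toℕ x₂' + toℕ x₁)))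
  ⊎ ((y₁ ≢ y₂) × (y₁' ≢ y₂') × (modN p (toℕ y₂ + toℕ y₁') ≡ modN p (toℕ y₂' + toℕ y₁)))

record FiberIsoWr {n r : ℕ} (X : CoherentConfiguration n r) (p : ℕ) (i : Fin r) : Set where
  open CoherentConfiguration X
  field
    φ    : Fin n → Fin p × Fin p
    ψ    : Fin p × Fin p → Fin n
    ψ∈   : ∀ x → col (ψ x) (ψ x) ≡ i
    φψ   : ∀ x → φ (ψ x) ≡ x
    ψφ   : ∀ α → col α α ≡ i → ψ (φ α) ≡ α
    resp : ∀ α β γ δ → col α α ≡ i → col β β ≡ i → col γ γ ≡ i → col δ δ ≡ i →
           (col α β ≡ col γ δ → WrSame p (φ α) (φ β) (φ γ) (φ δ)) ×
           (WrSame p (φ α) (φ β) (φ γ) (φ δ) → col α β ≡ col γ δ)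

-- Identify every fibre with ℤ_p × ℤ_p; then O_θ(S_k) consists of the translations inside the
-- blocks y = const. A relation s ∈ S_ij (i ≠ j) of valency p that is not regular meets every
-- block of Ω_j exactly once from each point of Ω_i: by coherence, two s-successors in one block
-- would make all s-neighbourhoods invariant under a nonzero translation, hence (p prime) unions
-- of whole blocks, and then s s* s = {s}. Fix (α₀, γ₀) ∈ s₃ and let a_t be the number of
-- s₁s₂-paths from α₀ to the t-successor of γ₀. Block-wise uniqueness gives
-- σ_{s₁}σ_{s₂} = σ_{s₃} Σ_t a_t σ_t and Σ_t a_t = n_{s₁} = p, while p Σ_t a_t a_{tu} counts pairs of
-- s₁-successors β, β' of α₀ weighted by (σ_{s₂} σ_u σ_{s₂*})_{ββ'}; this weight is 1 when β, β' lie
-- in different blocks of Ω_j, and p or 0 on the diagonal according as u = 1 or not.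

module Submission where

open import Defs
open import Data.Nat using (ℕ; zero; suc; _+_; _*_; _∸_; _≤_; _<_; z≤n; s≤s; NonZero; >-nonZero⁻¹; _%_; _/_)
open import Data.Nat.Properties hiding (_≟_; 0≢1+n)
open import Data.Nat.DivMod using (_mod_; m%n<n; m<n⇒m%n≡m; [m+n]%n≡m%n; [m+kn]%n≡m%n; m≡m%n+[m/n]*n; m%n%n≡m%n; %-distribˡ-+)
open import Data.Nat.Divisibility using (_∣_; n∣m⇒m%n≡0)
open import Data.Nat.Primality using (Prime; prime⇒irreducible)
open import Data.Nat.Coprimality using (Coprime; coprime-Bézout)
open import Data.Nat.GCD using (module Bézout)
open import Data.Fin using (Fin; toℕ; _≟_; punchIn; punchOut)
open import Data.Fin.Properties using (toℕ-injective; toℕ<n; toℕ-fromℕ<; punchInᵢ≢i; punchIn-punchOut; 0≢1+n)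
open import Data.Product using (Σ; _×_; _,_; proj₁; proj₂)
open import Data.Sum using (_⊎_; inj₁; inj₂)
open import Function using (_∘_)
open import Relation.Nullary using (¬_; yes; no; Dec; contradiction)
open import Data.Nat.Solver using (module +-*-Solver)
open import Relation.Binary.PropositionalEquality hiding (resp)

open import Algebra.Properties.CommutativeMonoid.Sum +-0-commutativeMonoid
  using (sum; sum-cong-≗; sum-remove; ∑-comm)
open import Algebra.Properties.Semiring.Sum +-*-semiring
  using (*-distribˡ-sum)

≟ᶜ-≡ : ∀ {r} {s t : Fin r} → s ≡ t → [ s ≟ᶜ t ] ≡ 1
≟ᶜ-≡ {s = s} {t} s≡t with s ≟ t
... | yes _   = refl
... | no s≢t = contradiction s≡t s≢t

≟ᶜ-≢ : ∀ {r} {s t : Fin r} → s ≢ t → [ s ≟ᶜ t ] ≡ 0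
≟ᶜ-≢ {s = s} {t} s≢t with s ≟ t
... | yes s≡t = contradiction s≡t s≢t
... | no _    = refl

≟ᶜ-pos⇒≡ : ∀ {r} {s t : Fin r} → 0 < [ s ≟ᶜ t ] → s ≡ t
≟ᶜ-pos⇒≡ {s = s} {t} h with s ≟ t
... | yes s≡t = s≡t

≟ᶜ-≤1 : ∀ {r} (s t : Fin r) → [ s ≟ᶜ t ] ≤ 1
≟ᶜ-≤1 s t with s ≟ t
... | yes _ = s≤s z≤n
... | no _  = z≤n

≟ᶜ-cases : ∀ {r} (s t : Fin r) → ([ s ≟ᶜ t ] ≡ 0 × s ≢ t) ⊎ ([ s ≟ᶜ t ] ≡ 1 × s ≡ t)
≟ᶜ-cases s t with s ≟ t
... | yes s≡t = inj₂ (refl , s≡t)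
... | no s≢t  = inj₁ (refl , s≢t)

sumF≡sum : ∀ {n} (f : Fin n → ℕ) → sumF f ≡ sum f
sumF≡sum {zero}  f = refl
sumF≡sum {suc n} f = cong (f Fin.zero +_) (sumF≡sum (f ∘ Fin.suc))

sumF-cong : ∀ {n} {f g : Fin n → ℕ} → (∀ i → f i ≡ g i) → sumF f ≡ sumF g
sumF-cong {f = f} {g} f≗g = trans (sumF≡sum f) (trans (sum-cong-≗ f≗g) (sym (sumF≡sum g)))

sumF-comm : ∀ {m n} (f : Fin m → Fin n → ℕ) →
  sumF (λ i → sumF (λ j → f i j)) ≡ sumF (λ j → sumF (λ i → f i j))
sumF-comm {m} {n} f = begin
  sumF (λ i → sumF (f i))         ≡⟨ sumF-cong (λ i → sumF≡sum (f i)) ⟩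
  sumF (λ i → sum (f i))          ≡⟨ sumF≡sum {m} _ ⟩
  sum (λ i → sum (f i))           ≡⟨ ∑-comm f ⟩
  sum (λ j → sum (λ i → f i j))   ≡⟨ sumF≡sum {n} _ ⟨
  sumF (λ j → sum (λ i → f i j))  ≡⟨ sumF-cong (λ j → sumF≡sum {m} (λ i → f i j)) ⟨
  sumF (λ j → sumF (λ i → f i j)) ∎
  where open ≡-Reasoning

sumF-*ˡ : ∀ {n} (c : ℕ) (f : Fin n → ℕ) → sumF (λ i → c * f i) ≡ c * sumF f
sumF-*ˡ {n} c f = trans (sumF≡sum {n} _) (trans (sym (*-distribˡ-sum c f)) (cong (c *_) (sym (sumF≡sum f))))

sumF-*ʳ : ∀ {n} (c : ℕ) (f : Fin n → ℕ) → sumF (λ i → f i * c) ≡ sumF f * c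
sumF-*ʳ c f = trans (sumF-cong (λ i → *-comm (f i) c)) (trans (sumF-*ˡ c f) (*-comm c _))

sumF-const : ∀ {n} (c : ℕ) → sumF {n} (λ _ → c) ≡ n * c
sumF-const {zero}  c = refl
sumF-const {suc n} c = cong (c +_) (sumF-const {n} c)

sumF-zero : ∀ {n} (f : Fin n → ℕ) → (∀ i → f i ≡ 0) → sumF f ≡ 0
sumF-zero {n} f f≗0 = trans (sumF-cong f≗0) (trans (sumF-const {n} 0) (*-zeroʳ n))

sumF-mono-≤ : ∀ {n} {f g : Fin n → ℕ} → (∀ i → f i ≤ g i) → sumF f ≤ sumF g
sumF-mono-≤ {zero}  f≤g = z≤n
sumF-mono-≤ {suc n} f≤g = +-mono-≤ (f≤g Fin.zero) (sumF-mono-≤ (f≤g ∘ Fin.suc))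

sumF-remove : ∀ {n} (f : Fin (suc n) → ℕ) (i : Fin (suc n)) → sumF f ≡ f i + sumF (f ∘ punchIn i)
sumF-remove {n} f i = trans (sumF≡sum f) (trans (sum-remove f) (cong (f i +_) (sym (sumF≡sum {n} _))))

sumF-single : ∀ {n} (f : Fin n → ℕ) (i : Fin n) → (∀ j → j ≢ i → f j ≡ 0) → sumF f ≡ f i
sumF-single {suc n} f i others = begin
  sumF f                     ≡⟨ sumF-remove f i ⟩
  f i + sumF (f ∘ punchIn i) ≡⟨ cong (f i +_) (sumF-zero _ (λ j → others _ (punchInᵢ≢i i j))) ⟩
  f i + 0                    ≡⟨ +-identityʳ (f i) ⟩
  f i                        ∎
  where open ≡-Reasoning

sumF-indicator : ∀ {n} (i : Fin n) (f : Fin n → ℕ) → sumF (λ j → [ i ≟ᶜ j ] * f j) ≡ f i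
sumF-indicator {n} i f = trans (sumF-single {n} _ i (λ j j≢i → cong (_* f j) (≟ᶜ-≢ (j≢i ∘ sym))))
                           (trans (cong (_* f i) (≟ᶜ-≡ {s = i} refl)) (+-identityʳ (f i)))

sumF-reindex : ∀ {m n} (c : Fin m → Fin n) (f : Fin n → ℕ) →
  (∀ t → 0 < f t → sumF (λ x → [ c x ≟ᶜ t ]) ≡ 1) → sumF (f ∘ c) ≡ sumF f
sumF-reindex {m} {n} c f once = begin
  sumF (f ∘ c)                                    ≡⟨ sumF-cong (λ x → sumF-indicator (c x) f) ⟨
  sumF (λ x → sumF (λ t → [ c x ≟ᶜ t ] * f t))    ≡⟨ sumF-comm {m} {n} (λ x t → [ c x ≟ᶜ t ] * f t) ⟩
  sumF (λ t → sumF (λ x → [ c x ≟ᶜ t ] * f t))    ≡⟨ sumF-cong (λ t → sumF-*ʳ {m} (f t) (λ x → [ c x ≟ᶜ t ])) ⟩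
  sumF (λ t → preimages t * f t)                  ≡⟨ sumF-cong weight-1 ⟩
  sumF f                                          ∎
  where
  open ≡-Reasoning
  preimages : Fin n → ℕ
  preimages t = sumF (λ x → [ c x ≟ᶜ t ])
  weight-1 : ∀ t → preimages t * f t ≡ f t
  weight-1 t with f t in ft
  ... | zero  = *-zeroʳ (preimages t)
  ... | suc k = trans (cong (_* suc k) (once t (subst (0 <_) (sym ft) (s≤s z≤n)))) (+-identityʳ (suc k))

sumF-bilinear : ∀ {m l} (c : Fin l → ℕ) (A : Fin m → ℕ) (D : Fin m → Fin l → ℕ) →
  sumF (λ ε → c ε * sumF (λ β → A β * D β ε)) ≡ sumF (λ β → A β * sumF (λ ε → c ε * D β ε))
sumF-bilinear {m} {l} c A D = begin
  sumF (λ ε → c ε * sumF (λ β → A β * D β ε))    ≡⟨ sumF-cong (λ ε → sumF-*ˡ {m} (c ε) (λ β → A β * D β ε)) ⟨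
  sumF (λ ε → sumF (λ β → c ε * (A β * D β ε)))  ≡⟨ sumF-comm {l} {m} (λ ε β → c ε * (A β * D β ε)) ⟩
  sumF (λ β → sumF (λ ε → c ε * (A β * D β ε)))  ≡⟨ sumF-cong (λ β → trans (sumF-cong (λ ε → swap (c ε) (A β) (D β ε)))
                                                                           (sumF-*ˡ {l} (A β) (λ ε → c ε * D β ε))) ⟩
  sumF (λ β → A β * sumF (λ ε → c ε * D β ε))    ∎
  where
  open ≡-Reasoning
  swap : ∀ x y z → x * (y * z) ≡ y * (x * z)
  swap x y z = trans (sym (*-assoc x y z)) (trans (cong (_* z) (*-comm x y)) (*-assoc y x z))

sumF-pull-inner : ∀ {a b c} (f : Fin b → ℕ) (g : Fin b → Fin c → ℕ) (h : Fin a → Fin c → ℕ) →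
  sumF (λ x → sumF (λ δ → f δ * sumF (λ ε → g δ ε * h x ε))) ≡ sumF (λ δ → f δ * sumF (λ ε → g δ ε * sumF (λ x → h x ε)))
sumF-pull-inner {a} {b} {c} f g h = begin
  sumF (λ x → sumF (λ δ → f δ * sumF (λ ε → g δ ε * h x ε)))  ≡⟨ sumF-comm {a} {b} (λ x δ → f δ * sumF (λ ε → g δ ε * h x ε)) ⟩
  sumF (λ δ → sumF (λ x → f δ * sumF (λ ε → g δ ε * h x ε)))  ≡⟨ sumF-cong (λ δ → trans (sumF-*ˡ {a} (f δ) _) (cong (f δ *_) (inner δ))) ⟩
  sumF (λ δ → f δ * sumF (λ ε → g δ ε * sumF (λ x → h x ε)))  ∎
  where
  open ≡-Reasoning
  inner : ∀ δ → sumF (λ x → sumF (λ ε → g δ ε * h x ε)) ≡ sumF (λ ε → g δ ε * sumF (λ x → h x ε))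
  inner δ = trans (sumF-comm {a} {c} (λ x ε → g δ ε * h x ε)) (sumF-cong (λ ε → sumF-*ˡ {a} (g δ ε) (λ x → h x ε)))

sumF-exchange : ∀ {n} (f g : Fin n → ℕ) (i : Fin n) → (∀ j → j ≢ i → f j ≡ g j) → sumF f + g i ≡ sumF g + f i
sumF-exchange {suc n} f g i agree = begin
  sumF f + g i                         ≡⟨ cong (_+ g i) (sumF-remove f i) ⟩
  f i + sumF (f ∘ punchIn i) + g i     ≡⟨ cong (λ R → f i + R + g i) (sumF-cong (λ j → agree _ (punchInᵢ≢i i j))) ⟩
  f i + sumF (g ∘ punchIn i) + g i     ≡⟨ regroup (f i) _ (g i) ⟩
  g i + sumF (g ∘ punchIn i) + f i     ≡⟨ cong (_+ f i) (sumF-remove g i) ⟨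
  sumF g + f i                         ∎
  where
  open ≡-Reasoning
  regroup : ∀ x y z → x + y + z ≡ z + y + x
  regroup = solve 3 (λ x y z → x :+ y :+ z := z :+ y :+ x) refl
    where open +-*-Solver

f≤sumF : ∀ {n} (f : Fin n → ℕ) (i : Fin n) → f i ≤ sumF f
f≤sumF {suc n} f i = ≤-trans (m≤m+n (f i) _) (≤-reflexive (sym (sumF-remove f i)))

f+f≤sumF : ∀ {n} (f : Fin n → ℕ) {i j : Fin n} → i ≢ j → f i + f j ≤ sumF f
f+f≤sumF {suc n} f {i} {j} i≢j = begin
  f i + f j                                ≡⟨ cong (λ k → f i + f k) (punchIn-punchOut i≢j) ⟨
  f i + f (punchIn i (punchOut i≢j))       ≤⟨ +-monoʳ-≤ (f i) (f≤sumF (f ∘ punchIn i) _) ⟩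
  f i + sumF (f ∘ punchIn i)               ≡⟨ sumF-remove f i ⟨
  sumF f                                   ∎
  where open ≤-Reasoning

sumF-pos : ∀ {n} (f : Fin n → ℕ) → 0 < sumF f → Σ (Fin n) λ i → 0 < f i
sumF-pos {suc n} f h with f Fin.zero in eq
... | suc _ = Fin.zero , subst (0 <_) (sym eq) (s≤s z≤n)
... | zero with sumF-pos (f ∘ Fin.suc) h
...   | i , fi>0 = Fin.suc i , fi>0

sumF-≤1 : ∀ {n} (f : Fin n → ℕ) → (∀ i → f i ≤ 1) → (∀ i j → 0 < f i → 0 < f j → i ≡ j) → sumF f ≤ 1
sumF-≤1 f f≤1 unique with sumF f in eq
... | zero  = z≤n
... | suc _ with sumF-pos f (subst (0 <_) (sym eq) (s≤s z≤n))
...   | i , fi>0 = subst (_≤ 1) (trans (sym (sumF-single f i others)) eq) (f≤1 i)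
  where
  others : ∀ j → j ≢ i → f j ≡ 0
  others j j≢i with f j in fj
  ... | zero  = refl
  ... | suc _ = contradiction (unique j i (subst (0 <_) (sym fj) (s≤s z≤n)) fi>0) j≢i

sumF-all1 : ∀ {n} (f : Fin n → ℕ) → (∀ i → f i ≤ 1) → sumF f ≡ n → ∀ i → f i ≡ 1
sumF-all1 {suc n} f f≤1 Σf≡n i = ≤-antisym (f≤1 i) (+-cancelʳ-≤ (sumF (f ∘ punchIn i)) 1 (f i) (begin
  1 + sumF (f ∘ punchIn i)  ≤⟨ +-monoʳ-≤ 1 (sumF-mono-≤ (f≤1 ∘ punchIn i)) ⟩
  1 + sumF {n} (λ _ → 1)     ≡⟨ cong suc (trans (sumF-const {n} 1) (*-identityʳ n)) ⟩
  suc n                      ≡⟨ trans (sym Σf≡n) (sumF-remove f i) ⟩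
  f i + sumF (f ∘ punchIn i) ∎))
  where open ≤-Reasoning

module _ {p : ℕ} .{{_ : NonZero p}} where

  toℕ-mod : ∀ z → toℕ (z mod p) ≡ z % p
  toℕ-mod z = toℕ-fromℕ< (m%n<n z p)

  mod-toℕ : ∀ x → toℕ x mod p ≡ x
  mod-toℕ x = toℕ-injective (trans (toℕ-mod (toℕ x)) (m<n⇒m%n≡m (toℕ<n x)))

  %-cong-+ʳ : ∀ {a b} c → a % p ≡ b % p → (a + c) % p ≡ (b + c) % p
  %-cong-+ʳ {a} {b} c a≡b = begin
    (a + c) % p             ≡⟨ %-distribˡ-+ a c p ⟩
    (a % p + c % p) % p     ≡⟨ cong (λ x → (x + c % p) % p) a≡b ⟩
    (b % p + c % p) % p     ≡⟨ %-distribˡ-+ b c p ⟨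
    (b + c) % p             ∎
    where open ≡-Reasoning

  -- Adding (p − 1) c to both sides turns the extra c into the multiple c p.
  %-cancel-+ʳ : ∀ {a b} c → (a + c) % p ≡ (b + c) % p → a % p ≡ b % p
  %-cancel-+ʳ {a} {b} c a+c≡b+c = trans (sym (+c-undone a)) (trans (%-cong-+ʳ ((p ∸ 1) * c) a+c≡b+c) (+c-undone b))
    where
    c+[p-1]c≡cp : c + (p ∸ 1) * c ≡ c * p
    c+[p-1]c≡cp = trans (cong (_* c) (m+[n∸m]≡n (>-nonZero⁻¹ p))) (*-comm p c)
    +c-undone : ∀ x → (x + c + (p ∸ 1) * c) % p ≡ x % p
    +c-undone x = trans (cong (_% p) (trans (+-assoc x c _) (cong (x +_) c+[p-1]c≡cp))) ([m+kn]%n≡m%n x c p)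

  %-+-complement : ∀ z w → (z + ((p ∸ z % p) + w)) % p ≡ w % p
  %-+-complement z w = begin
    (z + ((p ∸ r) + w)) % p                 ≡⟨ cong (λ x → (x + ((p ∸ r) + w)) % p) (m≡m%n+[m/n]*n z p) ⟩
    ((r + k * p) + ((p ∸ r) + w)) % p       ≡⟨ cong (_% p) (regroup r k p (p ∸ r) w) ⟩
    (w + ((r + (p ∸ r)) + k * p)) % p       ≡⟨ cong (λ x → (w + (x + k * p)) % p) (m+[n∸m]≡n (<⇒≤ (m%n<n z p))) ⟩
    (w + suc k * p) % p                     ≡⟨ [m+kn]%n≡m%n w (suc k) p ⟩
    w % p                                   ∎
    where
    open ≡-Reasoning
    open +-*-Solver
    r = z % p
    k = z / p
    regroup : ∀ r k p t w → (r + k * p) + (t + w) ≡ w + ((r + t) + k * p)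
    regroup = solve 5 (λ r k p t w → (r :+ k :* p) :+ (t :+ w) := w :+ ((r :+ t) :+ k :* p)) refl

  nonmultiple-coprime : Prime p → ∀ {d} → ¬ p ∣ d → Coprime d p
  nonmultiple-coprime p-prime p∤d (i∣d , i∣p) with prime⇒irreducible p-prime i∣p
  ... | inj₁ i≡1 = i≡1
  ... | inj₂ refl = contradiction i∣d p∤d

  -- Bézout for d and p makes 1 an integer combination of the shift d and the period p.
  shift-invariant⇒constant : Prime p → (P : ℕ → Set) → (∀ {a b} → a % p ≡ b % p → P a → P b) →
    ∀ d → ¬ p ∣ d → (∀ z → P z → P (z + d)) → (∀ z → P (z + d) → P z) → ∀ {z} w → P z → P w
  shift-invariant⇒constant p-prime P P-mod d p∤d up down {z} w Pz =
    P-mod (%-+-complement z w) (shift-any ((p ∸ z % p) + w) z Pz)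
    where
    up* : ∀ m z → P z → P (z + m * d)
    up* zero    z Pz = subst P (sym (+-identityʳ z)) Pz
    up* (suc m) z Pz = subst P (trans (+-assoc z (m * d) d) (cong (z +_) (+-comm (m * d) d))) (up (z + m * d) (up* m z Pz))
    down* : ∀ m z → P (z + m * d) → P z
    down* zero    z Pz = subst P (+-identityʳ z) Pz
    down* (suc m) z Pz = down* m z (down (z + m * d) (subst P (sym (trans (+-assoc z (m * d) d) (cong (z +_) (+-comm (m * d) d)))) Pz))
    shift-1 : ∀ z → P z → P (z + 1)
    shift-1 z Pz with coprime-Bézout (nonmultiple-coprime p-prime p∤d)
    ... | Bézout.+- x y 1+yp≡xd = P-mod (begin
      (z + x * d) % p          ≡⟨ cong (λ e → (z + e) % p) 1+yp≡xd ⟨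
      (z + (1 + y * p)) % p    ≡⟨ cong (_% p) (+-assoc z 1 (y * p)) ⟨
      (z + 1 + y * p) % p      ≡⟨ [m+kn]%n≡m%n (z + 1) y p ⟩
      (z + 1) % p              ∎) (up* x z Pz)
      where open ≡-Reasoning
    ... | Bézout.-+ x y 1+xd≡yp = down* x (z + 1) (P-mod (begin
      z % p                    ≡⟨ [m+kn]%n≡m%n z y p ⟨
      (z + y * p) % p          ≡⟨ cong (λ e → (z + e) % p) 1+xd≡yp ⟨
      (z + (1 + x * d)) % p    ≡⟨ cong (_% p) (+-assoc z 1 (x * d)) ⟨
      (z + 1 + x * d) % p      ∎) Pz)
      where open ≡-Reasoning
    shift-any : ∀ m z → P z → P (z + m)
    shift-any zero    z Pz = subst P (sym (+-identityʳ z)) Pz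
    shift-any (suc m) z Pz = subst P (trans (+-assoc z m 1) (cong (z +_) (+-comm m 1))) (shift-1 (z + m) (shift-any m z Pz))

*-pos⇒pos : ∀ a b → 0 < a * b → (0 < a) × (0 < b)
*-pos⇒pos (suc a) (suc b) _ = s≤s z≤n , s≤s z≤n
*-pos⇒pos (suc a) zero ab>0 = contradiction (subst (0 <_) (*-zeroʳ a) ab>0) (<-irrefl refl)

module Configuration {n r : ℕ} (X : CoherentConfiguration n r) where
  open CC X

  Path : Fin r → Fin r → Fin n → Fin n → Set
  Path s t α β = Σ (Fin n) λ γ → (col α γ ≡ s) × (col γ β ≡ t)

  path⇒pathCount-pos : ∀ {s t α β} → Path s t α β → 0 < pathCount col s t α β
  path⇒pathCount-pos {s} {t} {α} {β} (γ , αγ≡s , γβ≡t) =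
    ≤-trans (≤-reflexive (sym (cong₂ _*_ (≟ᶜ-≡ αγ≡s) (≟ᶜ-≡ γβ≡t)))) (f≤sumF (λ γ → σ col s α γ * σ col t γ β) γ)

  pathCount-pos⇒path : ∀ {s t α β} → 0 < pathCount col s t α β → Path s t α β
  pathCount-pos⇒path h with sumF-pos _ h
  ... | γ , γ-pos with *-pos⇒pos _ _ γ-pos
  ...   | αγ-pos , γβ-pos = γ , ≟ᶜ-pos⇒≡ αγ-pos , ≟ᶜ-pos⇒≡ γβ-pos

  path-transport : ∀ {s t α β α' β'} → col α β ≡ col α' β' → Path s t α β → Path s t α' β'
  path-transport {s} {t} {α} {β} {α'} {β'} same path =
    pathCount-pos⇒path (≤-trans (path⇒pathCount-pos path) (≤-reflexive (coherent s t α β α' β' same)))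

  sameColour⇒sameSourceFiber : ∀ {α β γ δ} → col α β ≡ col γ δ → col α α ≡ col γ γ
  sameColour⇒sameSourceFiber {α} {β} {γ} {δ} same with path-transport same (α , refl , refl)
  ... | ε , γε≡αα , _ = trans (sym γε≡αα) (cong (col γ) (sym (diagonal α γ ε (sym γε≡αα))))

  _ᵀ : Fin r → Fin r
  s ᵀ = col (proj₁ (proj₂ (nonempty s))) (proj₁ (nonempty s))

  colᵀ : ∀ {s α β} → col α β ≡ s → col β α ≡ s ᵀ
  colᵀ {s} {α} {β} αβ≡s = transpose α β _ _ (trans αβ≡s (sym (proj₂ (proj₂ (nonempty s)))))

  colᵀ⁻ : ∀ {s α β} → col β α ≡ s ᵀ → col α β ≡ s
  colᵀ⁻ {s} {α} {β} βα≡sᵀ = trans (transpose β α _ _ βα≡sᵀ) (proj₂ (proj₂ (nonempty s)))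

  sameColour⇒sameTargetFiber : ∀ {α β γ δ} → col α β ≡ col γ δ → col β β ≡ col δ δ
  sameColour⇒sameTargetFiber {α} {β} {γ} {δ} same = sameColour⇒sameSourceFiber (transpose α β γ δ same)

  σᵀ : ∀ s α β → σ col (s ᵀ) α β ≡ σ col s β α
  σᵀ s α β with col α β ≟ s ᵀ | col β α ≟ s
  ... | yes _      | yes _      = refl
  ... | no _       | no _       = refl
  ... | yes αβ≡sᵀ  | no βα≢s    = contradiction (colᵀ⁻ αβ≡sᵀ) βα≢s
  ... | no αβ≢sᵀ   | yes βα≡s   = contradiction (colᵀ βα≡s) αβ≢sᵀ

  StarOf⇒ᵀ : ∀ {s v} → StarOf s v → v ≡ s ᵀ
  StarOf⇒ᵀ {s} v-star = let (α , β , αβ≡s) = nonempty s in trans (sym (v-star α β αβ≡s)) (colᵀ αβ≡s)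

  InS-ᵀ : ∀ {s i j} → InS s i j → InS (s ᵀ) j i
  InS-ᵀ s∈Sij α β αβ≡sᵀ = let (β∈i , α∈j) = s∈Sij β α (colᵀ⁻ αβ≡sᵀ) in α∈j , β∈i

  InS-fibers-unique : ∀ {s i j i' j'} → InS s i j → InS s i' j' → (i ≡ i') × (j ≡ j')
  InS-fibers-unique {s} s∈Sij s∈Si'j' with nonempty s
  ... | α , β , αβ≡s = trans (sym (proj₁ (s∈Sij α β αβ≡s))) (proj₁ (s∈Si'j' α β αβ≡s))
                     , trans (sym (proj₂ (s∈Sij α β αβ≡s))) (proj₂ (s∈Si'j' α β αβ≡s))

  successor : ∀ {s i j α} → InS s i j → col α α ≡ i → Σ (Fin n) λ β → col α β ≡ s
  successor {s} s∈Sij α∈i with nonempty s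
  ... | α₀ , β₀ , α₀β₀≡s with path-transport (trans (proj₁ (s∈Sij α₀ β₀ α₀β₀≡s)) (sym α∈i)) (β₀ , α₀β₀≡s , colᵀ α₀β₀≡s)
  ...   | β , αβ≡s , _ = β , αβ≡s

  irregular-off-diagonal : (∀ s → (Σ (Fin r) λ c → IsFiber c × InS s c c) ⊎ ¬ Regular s) →
    ∀ {s i j} → InS s i j → i ≢ j → ¬ Regular s
  irregular-off-diagonal homogeneous-or-irregular {s} s∈Sij i≢j with homogeneous-or-irregular s
  ... | inj₂ irregular        = irregular
  ... | inj₁ (c , _ , s∈Scc) = let (i≡c , j≡c) = InS-fibers-unique s∈Sij s∈Scc in
                                contradiction (trans i≡c (sym j≡c)) i≢j

  outDeg≡valency : ∀ {s i j v α} → InS s i j → Valency s v → col α α ≡ i → outDeg col s α ≡ v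
  outDeg≡valency s∈Sij valency α∈i = let (β , αβ≡s) = successor s∈Sij α∈i in valency _ β αβ≡s

  σ-outside-source : ∀ {s i j α} → InS s i j → col α α ≢ i → ∀ γ → σ col s α γ ≡ 0
  σ-outside-source s∈Sij α∉i γ = ≟ᶜ-≢ (λ αγ≡s → α∉i (proj₁ (s∈Sij _ _ αγ≡s)))

  σ-outside-target : ∀ {s i j β} → InS s i j → col β β ≢ j → ∀ γ → σ col s γ β ≡ 0
  σ-outside-target s∈Sij β∉j γ = ≟ᶜ-≢ (λ γβ≡s → β∉j (proj₂ (s∈Sij _ _ γβ≡s)))

  σ-*-cong : ∀ {s α β m m'} → (col α β ≡ s → m ≡ m') → σ col s α β * m ≡ σ col s α β * m'
  σ-*-cong {s} {α} {β} {m} {m'} m≡m' with ≟ᶜ-cases (col α β) s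
  ... | inj₁ (σ≡0 , _)    = trans (cong (_* m) σ≡0) (cong (_* m') (sym σ≡0))
  ... | inj₂ (_ , αβ≡s)   = cong (σ col s α β *_) (m≡m' αβ≡s)

  σ-*-absorb : ∀ {s α β} m → (col α β ≡ s → m ≡ 1) → σ col s α β * m ≡ σ col s α β
  σ-*-absorb {s} {α} {β} m m≡1 = trans (σ-*-cong m≡1) (*-identityʳ (σ col s α β))

  σ-*-vanish : ∀ {s α β} m → (col α β ≡ s → m ≡ 0) → σ col s α β * m ≡ 0
  σ-*-vanish {s} {α} {β} m m≡0 = trans (σ-*-cong m≡0) (*-zeroʳ (σ col s α β))

  ClassFunction : (Fin n → Fin n → ℕ) → Set
  ClassFunction M = ∀ α β γ δ → col α β ≡ col γ δ → M α β ≡ M γ δ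

  -- Expand M as Σ_v c_v σ_v; each σ_v σ_w is a class function by coherence.
  ⊗σ-classFunction : ∀ {M} → ClassFunction M → ∀ w → ClassFunction (M ⊗ σ col w)
  ⊗σ-classFunction {M} M-class w α β γ δ same =
    trans (expand α β) (trans (sumF-cong (λ v → cong (c v *_) (coherent v w α β γ δ same))) (sym (expand γ δ)))
    where
    c : Fin r → ℕ
    c v = M (proj₁ (nonempty v)) (proj₁ (proj₂ (nonempty v)))
    M≡c : ∀ α γ → M α γ ≡ c (col α γ)
    M≡c α γ = M-class α γ _ _ (sym (proj₂ (proj₂ (nonempty (col α γ)))))
    expand : ∀ α β → (M ⊗ σ col w) α β ≡ sumF (λ v → c v * pathCount col v w α β)
    expand α β = begin
      sumF (λ γ → M α γ * σ col w γ β)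
        ≡⟨ sumF-cong (λ γ → cong (_* σ col w γ β) (trans (M≡c α γ) (sym (sumF-indicator (col α γ) c)))) ⟩
      sumF (λ γ → sumF (λ v → σ col v α γ * c v) * σ col w γ β)
        ≡⟨ sumF-cong (λ γ → trans (sym (sumF-*ʳ {r} (σ col w γ β) (λ v → σ col v α γ * c v))) (sumF-cong λ v → rearrange (σ col v α γ) (c v) _)) ⟩
      sumF (λ γ → sumF (λ v → c v * (σ col v α γ * σ col w γ β)))
        ≡⟨ sumF-comm {n} {r} _ ⟩
      sumF (λ v → sumF (λ γ → c v * (σ col v α γ * σ col w γ β)))
        ≡⟨ sumF-cong (λ v → sumF-*ˡ {n} (c v) _) ⟩
      sumF (λ v → c v * pathCount col v w α β) ∎
      where
      open ≡-Reasoning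
      rearrange : ∀ a b c → a * b * c ≡ b * (a * c)
      rearrange a b c = trans (cong (_* c) (*-comm a b)) (*-assoc b a c)

module WreathFiber (q : ℕ) {n r : ℕ} (X : CoherentConfiguration n r) (i : Fin r)
                   (I : FiberIsoWr X (suc (suc q)) i) where
  open CC X
  open Configuration X
  open FiberIsoWr I public

  p : ℕ
  p = suc (suc q)

  InFiber : Fin n → Set
  InFiber α = col α α ≡ i

  point : Fin p → Fin p → Fin n
  point x y = ψ (x , y)

  xOf yOf : Fin n → Fin p
  xOf α = proj₁ (φ α)
  yOf α = proj₂ (φ α)

  xℕ : Fin n → ℕ
  xℕ α = toℕ (xOf α)

  xℕ<p : ∀ α → xℕ α < p
  xℕ<p α = toℕ<n (xOf α)

  point-∈ : ∀ x y → InFiber (point x y)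
  point-∈ x y = ψ∈ (x , y)

  xOf-point : ∀ x y → xOf (point x y) ≡ x
  xOf-point x y = cong proj₁ (φψ (x , y))

  yOf-point : ∀ x y → yOf (point x y) ≡ y
  yOf-point x y = cong proj₂ (φψ (x , y))

  point-coords : ∀ {α} → InFiber α → point (xOf α) (yOf α) ≡ α
  point-coords {α} α∈ = ψφ α α∈

  coords-injective : ∀ {α β} → InFiber α → InFiber β → xOf α ≡ xOf β → yOf α ≡ yOf β → α ≡ β
  coords-injective α∈ β∈ x≡ y≡ = trans (sym (point-coords α∈)) (trans (cong₂ point x≡ y≡) (point-coords β∈))

  point-injective : ∀ {x y x' y'} → point x y ≡ point x' y' → (x ≡ x') × (y ≡ y')
  point-injective {x} {y} {x'} {y'} eq = trans (sym (xOf-point x y)) (trans (cong xOf eq) (xOf-point x' y'))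
                                       , trans (sym (yOf-point x y)) (trans (cong yOf eq) (yOf-point x' y'))

  crossBlock-colour : ∀ {α β δ} → InFiber α → InFiber β → InFiber δ → yOf α ≢ yOf β → yOf β ≡ yOf δ → col α β ≡ col α δ
  crossBlock-colour {α} α∈ β∈ δ∈ αβ β≡δ = proj₂ (resp _ _ _ _ α∈ β∈ α∈ δ∈)
    (inj₂ (αβ , (λ αδ → αβ (trans αδ (sym β≡δ))) , cong (λ y → (toℕ y + toℕ (yOf α)) % p) β≡δ))

  colour-sameBlock : ∀ {α β γ δ} → InFiber α → InFiber β → InFiber γ → InFiber δ → col α β ≡ col γ δ → yOf α ≡ yOf β →
    (yOf γ ≡ yOf δ) × ((xℕ β + xℕ γ) % p ≡ (xℕ δ + xℕ α) % p)
  colour-sameBlock α∈ β∈ γ∈ δ∈ same αβ with proj₁ (resp _ _ _ _ α∈ β∈ γ∈ δ∈) same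
  ... | inj₁ (_ , γδ , x-diff) = γδ , x-diff
  ... | inj₂ (αβ-differ , _)   = contradiction αβ αβ-differ

  sameBlock-colour-injective : ∀ {γ β β'} → InFiber γ → InFiber β → InFiber β' → yOf γ ≡ yOf β →
    col γ β ≡ col γ β' → β ≡ β'
  sameBlock-colour-injective {γ} {β} {β'} γ∈ β∈ β'∈ γβ same with colour-sameBlock γ∈ β∈ γ∈ β'∈ same γβ
  ... | γβ' , x-diff = coords-injective β∈ β'∈ (toℕ-injective xβ≡xβ') (trans (sym γβ) γβ')
    where
    xβ≡xβ' : xℕ β ≡ xℕ β'
    xβ≡xβ' = trans (sym (m<n⇒m%n≡m (xℕ<p β)))
               (trans (%-cancel-+ʳ {p} {xℕ β} {xℕ β'} (xℕ γ) x-diff) (m<n⇒m%n≡m (xℕ<p β')))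

  sameBlock⇒InO : ∀ {α β} → InFiber α → InFiber β → yOf α ≡ yOf β → InO i (col α β)
  sameBlock⇒InO {α} {β} α∈ β∈ αβ =
    (λ α' β' same → trans (sameColour⇒sameSourceFiber same) α∈ , trans (sameColour⇒sameTargetFiber same) β∈) ,
    single-successor
    where
    single-successor : ∀ α' β' → col α' β' ≡ col α β → outDeg col (col α β) α' ≡ 1
    single-successor α' β' same = trans (sumF-single _ β' others) (≟ᶜ-≡ same)
      where
      α'∈ = trans (sameColour⇒sameSourceFiber same) α∈
      β'∈ = trans (sameColour⇒sameTargetFiber same) β∈
      others : ∀ δ → δ ≢ β' → σ col (col α β) α' δ ≡ 0
      others δ δ≢β' with col α' δ ≟ col α β
      ... | no _   = refl
      ... | yes α'δ = contradiction
        (sameBlock-colour-injective α'∈ β'∈ (trans (sameColour⇒sameTargetFiber α'δ) β∈)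
           (proj₁ (colour-sameBlock α∈ β∈ α'∈ β'∈ (sym same) αβ)) (trans same (sym α'δ)))
        (δ≢β' ∘ sym)

  InO⇒InFiber : ∀ {t α β} → InO i t → col α β ≡ t → InFiber α × InFiber β
  InO⇒InFiber (t∈Si , _) αβ≡t = t∈Si _ _ αβ≡t

  -- Across blocks every relation of S_i has valency p ≥ 2.
  InO⇒sameBlock : ∀ {t α β} → InO i t → col α β ≡ t → yOf α ≡ yOf β
  InO⇒sameBlock {t} {α} {β} t∈O@(_ , valency-1) αβ≡t with yOf α ≟ yOf β
  ... | yes αβ = αβ
  ... | no αβ  = contradiction (subst (2 ≤_) (valency-1 α β αβ≡t) two-successors) λ { (s≤s ()) }
    where
    α∈ = proj₁ (InO⇒InFiber t∈O αβ≡t)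
    β∈ = proj₂ (InO⇒InFiber t∈O αβ≡t)
    t-to : ∀ x → col α (point x (yOf β)) ≡ t
    t-to x = trans (sym (crossBlock-colour α∈ β∈ (point-∈ _ _) αβ (sym (yOf-point _ _)))) αβ≡t
    two-successors : 2 ≤ outDeg col t α
    two-successors = ≤-trans (≤-reflexive (sym (cong₂ _+_ (≟ᶜ-≡ (t-to Fin.zero)) (≟ᶜ-≡ (t-to (Fin.suc Fin.zero))))))
      (f+f≤sumF (σ col t α) (λ eq → 0≢1+n (proj₁ (point-injective eq))))

  InO-functional : ∀ {t γ β β'} → InO i t → col γ β ≡ t → col γ β' ≡ t → β ≡ β'
  InO-functional t∈O γβ γβ' =
    sameBlock-colour-injective (proj₁ (InO⇒InFiber t∈O γβ)) (proj₂ (InO⇒InFiber t∈O γβ))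
      (proj₂ (InO⇒InFiber t∈O γβ')) (InO⇒sameBlock t∈O γβ) (trans γβ (sym γβ'))

  InO-total : ∀ {t γ} → InO i t → InFiber γ → Σ (Fin p) λ x → col γ (point x (yOf γ)) ≡ t
  InO-total {t} {γ} t∈O@(t∈Si , _) γ∈ with successor t∈Si γ∈
  ... | β , γβ≡t = xOf β , subst (λ δ → col γ δ ≡ t) β≡point γβ≡t
    where
    β≡point : β ≡ point (xOf β) (yOf γ)
    β≡point = trans (sym (point-coords (proj₂ (InO⇒InFiber t∈O γβ≡t)))) (cong (point (xOf β)) (sym (InO⇒sameBlock t∈O γβ≡t)))

  InO-preimages : ∀ {t γ} → InO i t → InFiber γ → sumF (λ x → [ col γ (point x (yOf γ)) ≟ᶜ t ]) ≡ 1
  InO-preimages {t} {γ} t∈O γ∈ with InO-total t∈O γ∈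
  ... | x₁ , hit = trans (sumF-single _ x₁ others) (≟ᶜ-≡ hit)
    where
    others : ∀ x → x ≢ x₁ → [ col γ (point x (yOf γ)) ≟ᶜ t ] ≡ 0
    others x x≢x₁ = ≟ᶜ-≢ (λ hit' → x≢x₁ (proj₁ (point-injective (InO-functional t∈O hit' hit))))

  preimages-point : ∀ {β} → InFiber β → sumF (λ y → sumF (λ x → [ point x y ≟ᶜ β ])) ≡ 1
  preimages-point {β} β∈ =
    trans (sumF-single _ (yOf β) other-block) (trans (sumF-single _ (xOf β) other-x) (≟ᶜ-≡ (point-coords β∈)))
    where
    other-block : ∀ y → y ≢ yOf β → sumF (λ x → [ point x y ≟ᶜ β ]) ≡ 0
    other-block y y≢ = sumF-zero _ (λ x → ≟ᶜ-≢ (λ eq → y≢ (trans (sym (yOf-point x y)) (cong yOf eq))))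
    other-x : ∀ x → x ≢ xOf β → [ point x (yOf β) ≟ᶜ β ] ≡ 0
    other-x x x≢ = ≟ᶜ-≢ (λ eq → x≢ (trans (sym (xOf-point x _)) (cong xOf eq)))

  sumF-fiber : (f : Fin n → ℕ) → (∀ β → 0 < f β → InFiber β) →
    sumF f ≡ sumF (λ y → sumF (λ x → f (point x y)))
  sumF-fiber f supported = sym (begin
    sumF (λ y → sumF (λ x → f (point x y)))
      ≡⟨ sumF-cong (λ y → sumF-cong (λ x → sumF-indicator (point x y) f)) ⟨
    sumF (λ y → sumF (λ x → sumF (λ β → [ point x y ≟ᶜ β ] * f β)))
      ≡⟨ sumF-cong {p} (λ y → sumF-comm {p} {n} (λ x β → [ point x y ≟ᶜ β ] * f β)) ⟩
    sumF (λ y → sumF (λ β → sumF (λ x → [ point x y ≟ᶜ β ] * f β)))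
      ≡⟨ sumF-comm {p} {n} (λ y β → sumF (λ x → [ point x y ≟ᶜ β ] * f β)) ⟩
    sumF (λ β → sumF (λ y → sumF (λ x → [ point x y ≟ᶜ β ] * f β)))
      ≡⟨ sumF-cong {n} (λ β → trans (sumF-cong {p} (λ y → sumF-*ʳ {p} (f β) (λ x → [ point x y ≟ᶜ β ])))
                                    (sumF-*ʳ {p} (f β) (λ y → sumF (λ x → [ point x y ≟ᶜ β ])))) ⟩
    sumF (λ β → preimages β * f β)
      ≡⟨ sumF-cong weight-1 ⟩
    sumF f ∎)
    where
    open ≡-Reasoning
    preimages : Fin n → ℕ
    preimages β = sumF (λ y → sumF (λ x → [ point x y ≟ᶜ β ]))
    weight-1 : ∀ β → preimages β * f β ≡ f β
    weight-1 β with f β in fβ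
    ... | zero  = *-zeroʳ (preimages β)
    ... | suc k = trans (cong (_* suc k) (preimages-point (supported β (subst (0 <_) (sym fβ) (s≤s z≤n)))))
                        (+-identityʳ (suc k))

module IrregularCross (q : ℕ) (p-prime : Prime (suc (suc q))) {n r : ℕ} (X : CoherentConfiguration n r)
                      {i j : Fin r} (J : FiberIsoWr X (suc (suc q)) j)
                      {s : Fin r} (s∈Sij : CC.InS X s i j) (valency : CC.Valency X s (suc (suc q)))
                      (irregular : ¬ CC.Regular X s) where
  open CC X
  open Configuration X
  open WreathFiber q X j J

  target∈ : ∀ {α β} → col α β ≡ s → InFiber β
  target∈ αβ≡s = proj₂ (s∈Sij _ _ αβ≡s)

  successorsIn : Fin n → Fin p → ℕ
  successorsIn α y = sumF (λ x → σ col s α (point x y))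

  successorsIn-total : ∀ {α β} → col α β ≡ s → sumF (successorsIn α) ≡ p
  successorsIn-total {α} {β} αβ≡s =
    trans (sym (sumF-fiber (σ col s α) (λ _ h → target∈ (≟ᶜ-pos⇒≡ h)))) (valency α β αβ≡s)

  Hit : Fin n → Fin p → ℕ → Set
  Hit α y z = col α (point (z mod p) y) ≡ s

  Hit-mod : ∀ {α y a b} → a % p ≡ b % p → Hit α y a → Hit α y b
  Hit-mod {α} {y} {a} {b} a≡b = subst (λ x → col α (point x y) ≡ s)
    (toℕ-injective (trans (toℕ-mod a) (trans a≡b (sym (toℕ-mod b)))))

  -- Coherence transports the configuration α → β, β' to every s-edge, shifting it by x β − x β'.
  shift-step : ∀ {α β β'} → col α β ≡ s → col α β' ≡ s → yOf β ≡ yOf β' →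
    ∀ {α' y} z → Hit α' y z → Hit α' y (z + (xℕ β + (p ∸ xℕ β')))
  shift-step {α} {β} {β'} αβ αβ' ββ' {α'} {y} z hit with path-transport (trans αβ' (sym hit)) (β , αβ , refl)
  ... | γ , α'γ , γδ≡ββ' = subst (λ w → col α' w ≡ s) γ≡point α'γ
    where
    d = xℕ β + (p ∸ xℕ β')
    δ = point (z mod p) y
    γ∈ = target∈ α'γ
    sameBlock = colour-sameBlock (target∈ αβ) (target∈ αβ') γ∈ (point-∈ _ _) (sym γδ≡ββ') ββ'
    regroup : ∀ a b t → a + (b + t) ≡ b + a + t
    regroup = solve 3 (λ a b t → a :+ (b :+ t) := b :+ a :+ t) refl
      where open +-*-Solver
    xγ : xℕ γ ≡ (z + d) % p
    xγ = begin
      xℕ γ                                   ≡⟨ m<n⇒m%n≡m (xℕ<p γ) ⟨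
      xℕ γ % p                               ≡⟨ [m+n]%n≡m%n (xℕ γ) p ⟨
      (xℕ γ + p) % p                         ≡⟨ cong (λ w → (xℕ γ + w) % p) (m+[n∸m]≡n (<⇒≤ (xℕ<p β'))) ⟨
      (xℕ γ + (xℕ β' + (p ∸ xℕ β'))) % p     ≡⟨ cong (_% p) (regroup (xℕ γ) (xℕ β') (p ∸ xℕ β')) ⟩
      (xℕ β' + xℕ γ + (p ∸ xℕ β')) % p       ≡⟨ %-cong-+ʳ {p} {xℕ β' + xℕ γ} {xℕ δ + xℕ β} (p ∸ xℕ β') (proj₂ sameBlock) ⟩
      (xℕ δ + xℕ β + (p ∸ xℕ β')) % p        ≡⟨ cong (_% p) (+-assoc (xℕ δ) (xℕ β) _) ⟩
      (xℕ δ + d) % p                         ≡⟨ cong (λ w → (toℕ w + d) % p) (xOf-point (z mod p) y) ⟩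
      (toℕ (z mod p) + d) % p                ≡⟨ cong (λ w → (w + d) % p) (toℕ-mod z) ⟩
      (z % p + d) % p                        ≡⟨ %-cong-+ʳ {p} {z % p} {z} d (m%n%n≡m%n z p) ⟩
      (z + d) % p                            ∎
      where open ≡-Reasoning
    γ≡point : γ ≡ point ((z + d) mod p) y
    γ≡point = coords-injective γ∈ (point-∈ _ _)
      (toℕ-injective (trans xγ (trans (sym (toℕ-mod (z + d))) (cong toℕ (sym (xOf-point _ _))))))
      (trans (proj₁ sameBlock) (trans (yOf-point _ _) (sym (yOf-point _ _))))

  FullBlocks : Set
  FullBlocks = ∀ {α δ} → col α δ ≡ s → ∀ x → col α (point x (yOf δ)) ≡ s

  sharedBlock⇒fullBlocks : ∀ {α β β'} → col α β ≡ s → col α β' ≡ s → yOf β ≡ yOf β' → β ≢ β' → FullBlocks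
  sharedBlock⇒fullBlocks {α} {β} {β'} αβ αβ' ββ' β≢β' {α'} {δ} α'δ x =
    subst (λ w → col α' (point w (yOf δ)) ≡ s) (mod-toℕ x)
      (shift-invariant⇒constant p-prime (Hit α' (yOf δ)) (λ {a} {b} → Hit-mod {a = a} {b}) d p∤d
        (shift-step αβ αβ' ββ') down {xℕ δ} (toℕ x) hit₀)
    where
    d = xℕ β + (p ∸ xℕ β')
    d' = xℕ β' + (p ∸ xℕ β)
    hit₀ : Hit α' (yOf δ) (xℕ δ)
    hit₀ = subst (λ w → col α' w ≡ s)
      (sym (trans (cong (λ w → point w (yOf δ)) (mod-toℕ (xOf δ))) (point-coords (target∈ α'δ)))) α'δ
    d+d'≡p+p : d + d' ≡ p + p
    d+d'≡p+p = trans (regroup (xℕ β) (p ∸ xℕ β') (xℕ β') (p ∸ xℕ β))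
                     (cong₂ _+_ (m+[n∸m]≡n (<⇒≤ (xℕ<p β))) (m+[n∸m]≡n (<⇒≤ (xℕ<p β'))))
      where
      regroup : ∀ a b c e → (a + b) + (c + e) ≡ (a + e) + (c + b)
      regroup = solve 4 (λ a b c e → (a :+ b) :+ (c :+ e) := (a :+ e) :+ (c :+ b)) refl
        where open +-*-Solver
    down : ∀ z → Hit α' (yOf δ) (z + d) → Hit α' (yOf δ) z
    down z hit = Hit-mod {a = z + d + d'} {b = z} (begin
      (z + d + d') % p        ≡⟨ cong (_% p) (trans (+-assoc z d d') (cong (z +_) (trans d+d'≡p+p (cong (p +_) (sym (+-identityʳ p)))))) ⟩
      (z + 2 * p) % p         ≡⟨ [m+kn]%n≡m%n z 2 p ⟩
      z % p                   ∎) (shift-step αβ' αβ (sym ββ') (z + d) hit)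
      where open ≡-Reasoning
    p∤d : ¬ p ∣ d
    p∤d p∣d = β≢β' (coords-injective (target∈ αβ) (target∈ αβ') (toℕ-injective xβ≡xβ') ββ')
      where
      open ≡-Reasoning
      xβ≡xβ' : xℕ β ≡ xℕ β'
      xβ≡xβ' = begin
        xℕ β               ≡⟨ m<n⇒m%n≡m (xℕ<p β) ⟨
        xℕ β % p           ≡⟨ [m+n]%n≡m%n (xℕ β) p ⟨
        (xℕ β + p) % p     ≡⟨ cong (λ w → (xℕ β + w) % p) (m∸n+n≡m (<⇒≤ (xℕ<p β'))) ⟨
        (xℕ β + (p ∸ xℕ β' + xℕ β')) % p ≡⟨ cong (_% p) (+-assoc (xℕ β) _ (xℕ β')) ⟨
        (d + xℕ β') % p    ≡⟨ %-cong-+ʳ {p} {d} {0} (xℕ β') (n∣m⇒m%n≡0 d p p∣d) ⟩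
        xℕ β' % p          ≡⟨ m<n⇒m%n≡m (xℕ<p β') ⟩
        xℕ β'              ∎

  fullBlocks⇒singleBlock : FullBlocks → ∀ {γ β β'} → col γ β ≡ s → col γ β' ≡ s → yOf β ≡ yOf β'
  fullBlocks⇒singleBlock full {γ} {β} {β'} γβ γβ' with yOf β ≟ yOf β'
  ... | yes ββ' = ββ'
  ... | no ββ'-differ = contradiction (begin
      p + 1                                             ≤⟨ +-mono-≤ (≤-reflexive (sym full-block)) hit-β' ⟩
      successorsIn γ (yOf β) + successorsIn γ (yOf β')  ≤⟨ f+f≤sumF (successorsIn γ) ββ'-differ ⟩
      sumF (successorsIn γ)                             ≡⟨ successorsIn-total γβ ⟩
      p                                                 ∎) (m+1+n≰m p)
    where
    open ≤-Reasoning
    full-block : successorsIn γ (yOf β) ≡ p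
    full-block = trans (sumF-cong (λ x → ≟ᶜ-≡ (full γβ x))) (trans (sumF-const {p} 1) (*-identityʳ p))
    hit-β' : 1 ≤ successorsIn γ (yOf β')
    hit-β' = ≤-trans (≤-reflexive (sym (≟ᶜ-≡ (subst (λ w → col γ w ≡ s) (sym (point-coords (target∈ γβ'))) γβ'))))
                     (f≤sumF (λ x → σ col s γ (point x (yOf β'))) (xOf β'))

  fullBlocks⇒regular : FullBlocks → Regular s
  fullBlocks⇒regular full u = sss⊆s , λ u≡s → subst ((⟦ s ⟧ ⋆ StarOf s) ⋆ ⟦ s ⟧) (sym u≡s) s∈sss
    where
    sss⊆s : ((⟦ s ⟧ ⋆ StarOf s) ⋆ ⟦ s ⟧) u → u ≡ s
    sss⊆s (t , v , (s' , v' , s'≡s , v'-star , α₂ , β₂ , α₂β₂≡t , pc₂) , v≡s , α , β , αβ≡u , pc)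
      with pathCount-pos⇒path pc | pathCount-pos⇒path pc₂
    ... | γ , αγ≡t , γβ≡v | γ₂ , α₂γ₂≡s' , γ₂β₂≡v'
      with path-transport (trans α₂β₂≡t (sym αγ≡t)) (γ₂ , trans α₂γ₂≡s' s'≡s , trans γ₂β₂≡v' (StarOf⇒ᵀ v'-star))
    ...   | ζ , αζ≡s , ζγ≡sᵀ = trans (sym αβ≡u) (subst (λ w → col α w ≡ s) β≡point (full αζ≡s (xOf β)))
      where
      γβ≡s = trans γβ≡v v≡s
      β≡point : point (xOf β) (yOf ζ) ≡ β
      β≡point = trans (cong (point (xOf β)) (sym (fullBlocks⇒singleBlock full γβ≡s (colᵀ⁻ ζγ≡sᵀ))))
                      (point-coords (target∈ γβ≡s))
    s∈sss : ((⟦ s ⟧ ⋆ StarOf s) ⋆ ⟦ s ⟧) s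
    s∈sss = let (α₀ , β₀ , α₀β₀≡s) = nonempty s in
      col α₀ α₀ , s , (s , s ᵀ , refl , (λ _ _ → colᵀ) , α₀ , α₀ , refl , path⇒pathCount-pos (β₀ , α₀β₀≡s , colᵀ α₀β₀≡s)) ,
      refl , α₀ , β₀ , α₀β₀≡s , path⇒pathCount-pos (α₀ , refl , α₀β₀≡s)

  atMostOncePerBlock : ∀ {α β β'} → col α β ≡ s → col α β' ≡ s → yOf β ≡ yOf β' → β ≡ β'
  atMostOncePerBlock {β = β} {β'} αβ αβ' ββ' with β ≟ β'
  ... | yes β≡β' = β≡β'
  ... | no β≢β'  = contradiction (fullBlocks⇒regular (sharedBlock⇒fullBlocks αβ αβ' ββ' β≢β')) irregular

  successorsIn≡1 : ∀ {α} → col α α ≡ i → ∀ y → successorsIn α y ≡ 1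
  successorsIn≡1 {α} α∈ = sumF-all1 (successorsIn α) at-most-1 (successorsIn-total (proj₂ (successor s∈Sij α∈)))
    where
    at-most-1 : ∀ y → successorsIn α y ≤ 1
    at-most-1 y = sumF-≤1 _ (λ x → ≟ᶜ-≤1 _ _) λ x x' hit hit' →
      proj₁ (point-injective (atMostOncePerBlock (≟ᶜ-pos⇒≡ hit) (≟ᶜ-pos⇒≡ hit') (trans (yOf-point x y) (sym (yOf-point x' y)))))

  oncePerBlock : ∀ {α} → col α α ≡ i → ∀ y → Σ (Fin p) λ x → col α (point x y) ≡ s
  oncePerBlock α∈ y with sumF-pos _ (≤-reflexive (sym (successorsIn≡1 α∈ y)))
  ... | x , hit = x , ≟ᶜ-pos⇒≡ hit

module Triangle (q : ℕ) (p-prime : Prime (suc (suc q))) {n r : ℕ} (X : CoherentConfiguration n r)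
  (wreath : ∀ i → CC.IsFiber X i → FiberIsoWr X (suc (suc q)) i)
  (valency : ∀ s i j → CC.IsFiber X i → CC.IsFiber X j → i ≢ j → CC.InS X s i j → CC.Valency X s (suc (suc q)))
  (irregular : ∀ {s i j} → CC.InS X s i j → i ≢ j → ¬ CC.Regular X s)
  {i j k : Fin r} (i-fiber : CC.IsFiber X i) (j-fiber : CC.IsFiber X j) (k-fiber : CC.IsFiber X k)
  (i≢j : i ≢ j) (j≢k : j ≢ k) (i≢k : i ≢ k)
  {s₁ s₂ s₃ : Fin r} (s₁∈ : CC.InS X s₁ i j) (s₂∈ : CC.InS X s₂ j k) (s₃∈ : CC.InS X s₃ i k) where

  open CC X
  open Configuration X

  p : ℕ
  p = suc (suc q)

  module Ωj = WreathFiber q X j (wreath j j-fiber)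
  module Ωk = WreathFiber q X k (wreath k k-fiber)
  open Ωk using (point; yOf; point-∈; yOf-point; point-injective; point-coords;
                 sameBlock⇒InO; InO⇒sameBlock; InO⇒InFiber; InO-functional; InO-total; InO-preimages)

  module S₁ = IrregularCross q p-prime X (wreath j j-fiber) s₁∈ (valency s₁ i j i-fiber j-fiber i≢j s₁∈) (irregular s₁∈ i≢j)
  module S₂ = IrregularCross q p-prime X (wreath k k-fiber) s₂∈ (valency s₂ j k j-fiber k-fiber j≢k s₂∈) (irregular s₂∈ j≢k)
  module S₃ = IrregularCross q p-prime X (wreath k k-fiber) s₃∈ (valency s₃ i k i-fiber k-fiber i≢k s₃∈) (irregular s₃∈ i≢k)
  module S₂ᵀ = IrregularCross q p-prime X (wreath j j-fiber) (InS-ᵀ s₂∈)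
    (valency (s₂ ᵀ) k j k-fiber j-fiber (j≢k ∘ sym) (InS-ᵀ s₂∈)) (irregular (InS-ᵀ s₂∈) (j≢k ∘ sym))

  P : Fin n → Fin n → ℕ
  P = pathCount col s₁ s₂

  α₀ γ₀ : Fin n
  α₀ = proj₁ (nonempty s₃)
  γ₀ = proj₁ (proj₂ (nonempty s₃))

  α₀γ₀ : col α₀ γ₀ ≡ s₃
  α₀γ₀ = proj₂ (proj₂ (nonempty s₃))

  α₀∈ : col α₀ α₀ ≡ i
  α₀∈ = proj₁ (s₃∈ _ _ α₀γ₀)

  γ₀∈ : col γ₀ γ₀ ≡ k
  γ₀∈ = proj₂ (s₃∈ _ _ α₀γ₀)

  y₀ : Fin p
  y₀ = yOf γ₀

  a-terms : Fin r → Fin p → ℕ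
  a-terms t x = [ col γ₀ (point x y₀) ≟ᶜ t ] * P α₀ (point x y₀)

  a : Fin r → ℕ
  a t = sumF (a-terms t)

  blockColour-InO : ∀ {γ} → col γ γ ≡ k → ∀ x → InO k (col γ (point x (yOf γ)))
  blockColour-InO γ∈ x = sameBlock⇒InO γ∈ (point-∈ _ _) (sym (yOf-point _ _))

  a-pos⇒InO : ∀ t → 0 < a t → InO k t
  a-pos⇒InO t a>0 with sumF-pos (a-terms t) a>0
  ... | x , term>0 = subst (InO k) (≟ᶜ-pos⇒≡ (proj₁ (*-pos⇒pos _ (P α₀ (point x y₀)) term>0))) (blockColour-InO γ₀∈ x)

  a-at : ∀ x → a (col γ₀ (point x y₀)) ≡ P α₀ (point x y₀)
  a-at x = trans (sumF-single (a-terms (col γ₀ (point x y₀))) x others)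
                 (trans (cong (_* P α₀ (point x y₀)) (≟ᶜ-≡ {s = col γ₀ (point x y₀)} refl)) (+-identityʳ _))
    where
    others : ∀ x' → x' ≢ x → [ col γ₀ (point x' y₀) ≟ᶜ col γ₀ (point x y₀) ] * P α₀ (point x' y₀) ≡ 0
    others x' x'≢x = cong (_* P α₀ (point x' y₀))
      (≟ᶜ-≢ (λ same → x'≢x (proj₁ (point-injective (InO-functional (blockColour-InO γ₀∈ x) same refl)))))

  a-outside-O : ∀ t → ¬ InO k t → a t ≡ 0
  a-outside-O t t∉O with a t in at
  ... | zero  = refl
  ... | suc _ = contradiction (a-pos⇒InO t (subst (0 <_) (sym at) (s≤s z≤n))) t∉O

  -- Coherence moves (α₀, γ₀) onto any s₃-edge (α, γ), and the thin relation col γ δ pins down δ.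
  a-represents-P : ∀ {α γ δ} → col α γ ≡ s₃ → col δ δ ≡ k → yOf γ ≡ yOf δ → P α δ ≡ a (col γ δ)
  a-represents-P {α} {γ} {δ} αγ δ∈ γδ = begin
    P α δ                   ≡⟨ coherent s₁ s₂ α δ α₀ δₓ (subst (λ w → col α w ≡ col α₀ δₓ) δ'≡δ αδ'≡α₀δₓ) ⟩
    P α₀ δₓ                 ≡⟨ a-at x ⟨
    a (col γ₀ δₓ)           ≡⟨ cong a γ₀δₓ≡γδ ⟩
    a (col γ δ)             ∎
    where
    open ≡-Reasoning
    γδ∈O = sameBlock⇒InO (proj₂ (s₃∈ _ _ αγ)) δ∈ γδ
    x = proj₁ (InO-total γδ∈O γ₀∈)
    δₓ = point x y₀
    γ₀δₓ≡γδ : col γ₀ δₓ ≡ col γ δ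
    γ₀δₓ≡γδ = proj₂ (InO-total γδ∈O γ₀∈)
    transported : Path (col α₀ δₓ) (col δₓ γ₀) α γ
    transported = path-transport (trans α₀γ₀ (sym αγ)) (δₓ , refl , refl)
    δ' = proj₁ transported
    αδ'≡α₀δₓ : col α δ' ≡ col α₀ δₓ
    αδ'≡α₀δₓ = proj₁ (proj₂ transported)
    δ'≡δ : δ' ≡ δ
    δ'≡δ = InO-functional γδ∈O (trans (transpose δ' γ δₓ γ₀ (proj₂ (proj₂ transported))) γ₀δₓ≡γδ) refl

  sum-a-over-block : ∀ {γ} → col γ γ ≡ k → (g : Fin r → ℕ) →
    sumF (λ t → a t * g t) ≡ sumF (λ x → a (col γ (point x (yOf γ))) * g (col γ (point x (yOf γ))))
  sum-a-over-block {γ} γ∈ g = sym (sumF-reindex (λ x → col γ (point x (yOf γ))) (λ t → a t * g t)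
    (λ t at*gt>0 → InO-preimages (a-pos⇒InO t (proj₁ (*-pos⇒pos _ _ at*gt>0))) γ∈))

  Σaσ≡a : ∀ γ δ → sumF (λ t → a t * σ col t γ δ) ≡ a (col γ δ)
  Σaσ≡a γ δ = trans (sumF-cong (λ t → *-comm (a t) (σ col t γ δ))) (sumF-indicator (col γ δ) a)

  product-other-terms : ∀ {α β γₛ} → col β β ≡ k → col α γₛ ≡ s₃ → yOf γₛ ≡ yOf β →
    ∀ γ → γ ≢ γₛ → σ col s₃ α γ * a (col γ β) ≡ 0
  product-other-terms {α} {β} {γₛ} β∈ αγₛ γₛβ γ γ≢γₛ = σ-*-vanish {s₃} {α} {γ} (a (col γ β)) vanish
    where
    vanish : col α γ ≡ s₃ → a (col γ β) ≡ 0
    vanish αγ = a-outside-O (col γ β) (λ γβ∈O →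
      γ≢γₛ (S₃.atMostOncePerBlock αγ αγₛ (trans (InO⇒sameBlock γβ∈O refl) (sym γₛβ))))

  product-entry-inside : ∀ {α β} → col α α ≡ i → col β β ≡ k → P α β ≡ sumF (λ γ → σ col s₃ α γ * a (col γ β))
  product-entry-inside {α} {β} α∈ β∈ = sym (begin
    sumF (λ γ → σ col s₃ α γ * a (col γ β))  ≡⟨ sumF-single _ γₛ (product-other-terms β∈ αγₛ γₛβ) ⟩
    σ col s₃ α γₛ * a (col γₛ β)             ≡⟨ cong (_* a (col γₛ β)) (≟ᶜ-≡ αγₛ) ⟩
    1 * a (col γₛ β)                        ≡⟨ *-identityˡ _ ⟩
    a (col γₛ β)                            ≡⟨ a-represents-P αγₛ β∈ γₛβ ⟨
    P α β                                   ∎)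
    where
    open ≡-Reasoning
    γₛ = point (proj₁ (S₃.oncePerBlock α∈ (yOf β))) (yOf β)
    αγₛ : col α γₛ ≡ s₃
    αγₛ = proj₂ (S₃.oncePerBlock α∈ (yOf β))
    γₛβ : yOf γₛ ≡ yOf β
    γₛβ = yOf-point _ _

  product-entry : ∀ α β → P α β ≡ sumF (λ γ → σ col s₃ α γ * a (col γ β))
  product-entry α β = by-cases (col α α ≟ i) (col β β ≟ k)
    where
    by-cases : Dec (col α α ≡ i) → Dec (col β β ≡ k) → P α β ≡ sumF (λ γ → σ col s₃ α γ * a (col γ β))
    by-cases (yes α∈) (yes β∈) = product-entry-inside α∈ β∈
    by-cases (no α∉)  _        = trans (sumF-zero _ λ γ → cong (_* σ col s₂ γ β) (σ-outside-source s₁∈ α∉ γ))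
                                       (sym (sumF-zero _ λ γ → cong (_* a (col γ β)) (σ-outside-source s₃∈ α∉ γ)))
    by-cases (yes _)  (no β∉)  = trans (sumF-zero _ λ γ → trans (cong (σ col s₁ α γ *_) (σ-outside-target s₂∈ β∉ γ)) (*-zeroʳ (σ col s₁ α γ)))
                                       (sym (sumF-zero _ λ γ → trans (cong (σ col s₃ α γ *_) (a-outside-O _ (β-outside γ))) (*-zeroʳ (σ col s₃ α γ))))
      where
      β-outside : ∀ γ → ¬ InO k (col γ β)
      β-outside γ γβ∈O = β∉ (proj₂ (InO⇒InFiber γβ∈O refl))

  product-decomposition : ∀ α β → (σ col s₁ ⊗ σ col s₂) α β ≡ (σ col s₃ ⊗ (λ γ δ → sumF (λ t → a t * σ col t γ δ))) α β
  product-decomposition α β = trans (product-entry α β) (sumF-cong (λ γ → cong (σ col s₃ α γ *_) (sym (Σaσ≡a γ β))))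

  A : Fin n → ℕ
  A = σ col s₁ α₀

  outDeg-α₀ : outDeg col s₁ α₀ ≡ p
  outDeg-α₀ = outDeg≡valency s₁∈ (valency s₁ i j i-fiber j-fiber i≢j s₁∈) α₀∈

  outDeg-s₂ : ∀ {β} → col β β ≡ j → outDeg col s₂ β ≡ p
  outDeg-s₂ β∈ = outDeg≡valency s₂∈ (valency s₂ j k j-fiber k-fiber j≢k s₂∈) β∈

  sum-a : sumF a ≡ p
  sum-a = begin
    sumF a                                             ≡⟨ sumF-cong (λ t → *-identityʳ (a t)) ⟨
    sumF (λ t → a t * 1)                               ≡⟨ sum-a-over-block γ₀∈ (λ _ → 1) ⟩
    sumF (λ x → a (col γ₀ (point x y₀)) * 1)            ≡⟨ sumF-cong (λ x → trans (*-identityʳ _) (a-at x)) ⟩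
    sumF (λ x → sumF (λ β → σ col s₁ α₀ β * σ col s₂ β (point x y₀)))
      ≡⟨ sumF-comm {p} {n} (λ x β → σ col s₁ α₀ β * σ col s₂ β (point x y₀)) ⟩
    sumF (λ β → sumF (λ x → σ col s₁ α₀ β * σ col s₂ β (point x y₀)))
      ≡⟨ sumF-cong (λ β → sumF-*ˡ {p} (σ col s₁ α₀ β) (λ x → σ col s₂ β (point x y₀))) ⟩
    sumF (λ β → σ col s₁ α₀ β * S₂.successorsIn β y₀)
      ≡⟨ sumF-cong (λ β → σ-*-absorb {s₁} {α₀} {β} (S₂.successorsIn β y₀) (λ α₀β → S₂.successorsIn≡1 (proj₂ (s₁∈ _ _ α₀β)) y₀)) ⟩
    outDeg col s₁ α₀                                   ≡⟨ outDeg-α₀ ⟩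
    p                                                  ∎
    where open ≡-Reasoning

  -- V u = σ_{s₂} σ_u σ_{s₂*}, and for thin u, W u δ = P α₀ (δ u).
  V : Fin r → Fin n → Fin n → ℕ
  V u β β' = sumF (λ δ → σ col s₂ β δ * sumF (λ ε → σ col u δ ε * σ col s₂ β' ε))

  W : Fin r → Fin n → ℕ
  W u δ = sumF (λ ε → σ col u δ ε * P α₀ ε)

  ΣPW≡ΣAAV : ∀ u → sumF (λ δ → P α₀ δ * W u δ) ≡ sumF (λ β → A β * sumF (λ β' → A β' * V u β β'))
  ΣPW≡ΣAAV u = begin
    sumF (λ δ → P α₀ δ * W u δ)                            ≡⟨ sumF-cong (λ δ → *-comm (P α₀ δ) (W u δ)) ⟩
    sumF (λ δ → W u δ * sumF (λ β → A β * σ col s₂ β δ))   ≡⟨ sumF-bilinear (W u) A (σ col s₂) ⟩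
    sumF (λ β → A β * sumF (λ δ → W u δ * σ col s₂ β δ))   ≡⟨ sumF-cong (λ β → cong (A β *_) (inner β)) ⟩
    sumF (λ β → A β * sumF (λ β' → A β' * V u β β'))       ∎
    where
    open ≡-Reasoning
    K : Fin n → Fin n → ℕ
    K δ β' = sumF (λ ε → σ col u δ ε * σ col s₂ β' ε)
    inner : ∀ β → sumF (λ δ → W u δ * σ col s₂ β δ) ≡ sumF (λ β' → A β' * V u β β')
    inner β = begin
      sumF (λ δ → W u δ * σ col s₂ β δ)
        ≡⟨ sumF-cong (λ δ → trans (*-comm (W u δ) _) (cong (σ col s₂ β δ *_) (sumF-bilinear (σ col u δ) A (σ col s₂)))) ⟩
      sumF (λ δ → σ col s₂ β δ * sumF (λ β' → A β' * K δ β'))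
        ≡⟨ sumF-bilinear (σ col s₂ β) A (λ β' δ → K δ β') ⟩
      sumF (λ β' → A β' * V u β β') ∎

  P-pos⇒target∈ : ∀ {α δ} → 0 < P α δ → col δ δ ≡ k
  P-pos⇒target∈ P>0 = let (_ , _ , βδ) = pathCount-pos⇒path P>0 in proj₂ (s₂∈ _ _ βδ)

  module Thin {u : Fin r} (u∈O : InO k u) where

    W-at-successor : ∀ {δ ε} → col δ ε ≡ u → W u δ ≡ P α₀ ε
    W-at-successor {δ} {ε} δε = trans (sumF-single _ ε others) (trans (cong (_* P α₀ ε) (≟ᶜ-≡ δε)) (*-identityˡ _))
      where
      others : ∀ ε' → ε' ≢ ε → σ col u δ ε' * P α₀ ε' ≡ 0
      others ε' ε'≢ε = cong (_* P α₀ ε') (≟ᶜ-≢ (λ δε' → ε'≢ε (InO-functional u∈O δε' δε)))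

    a∘m-represents-W : (m : Fin r → Fin r) → (∀ t → InO k t → IsComp t u (m t)) →
      ∀ {γ δ} → col α₀ γ ≡ s₃ → col δ δ ≡ k → yOf γ ≡ yOf δ → a (m (col γ δ)) ≡ W u δ
    a∘m-represents-W m m-comp {γ} {δ} α₀γ δ∈ γδ = begin
      a (m (col γ δ))  ≡⟨ cong a (sym (m-comp (col γ δ) (sameBlock⇒InO γ∈ δ∈ γδ) γ δ ε refl δε)) ⟩
      a (col γ ε)      ≡⟨ a-represents-P α₀γ (point-∈ _ _) (trans γδ (sym (yOf-point _ _))) ⟨
      P α₀ ε           ≡⟨ W-at-successor δε ⟨
      W u δ            ∎
      where
      open ≡-Reasoning
      γ∈ = proj₂ (s₃∈ _ _ α₀γ)
      ε = point (proj₁ (InO-total u∈O δ∈)) (yOf δ)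
      δε : col δ ε ≡ u
      δε = proj₂ (InO-total u∈O δ∈)

    -- Each block of Ω_k contributes Σ_t a_t a_{tu} to Σ_δ P α₀ δ · P α₀ (δ u).
    ΣPW≡p*Σa·a∘m : (m : Fin r → Fin r) → (∀ t → InO k t → IsComp t u (m t)) →
      sumF (λ δ → P α₀ δ * W u δ) ≡ p * sumF (λ t → a t * a (m t))
    ΣPW≡p*Σa·a∘m m m-comp = begin
      sumF (λ δ → P α₀ δ * W u δ)
        ≡⟨ Ωk.sumF-fiber (λ δ → P α₀ δ * W u δ) (λ δ h → P-pos⇒target∈ (proj₁ (*-pos⇒pos _ _ h))) ⟩
      sumF (λ y → sumF (λ x → P α₀ (point x y) * W u (point x y)))
        ≡⟨ sumF-cong block ⟩
      sumF {p} (λ _ → sumF (λ t → a t * a (m t)))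
        ≡⟨ sumF-const {p} (sumF (λ t → a t * a (m t))) ⟩
      p * sumF (λ t → a t * a (m t)) ∎
      where
      open ≡-Reasoning
      block-via : ∀ {γ} → col α₀ γ ≡ s₃ →
        sumF (λ x → P α₀ (point x (yOf γ)) * W u (point x (yOf γ))) ≡ sumF (λ t → a t * a (m t))
      block-via {γ} α₀γ = sym (trans (sum-a-over-block γ∈ (λ t → a (m t))) (sumF-cong {p} λ x →
          cong₂ _*_ (sym (a-represents-P α₀γ (point-∈ x (yOf γ)) (sym (yOf-point x (yOf γ)))))
                    (a∘m-represents-W m m-comp α₀γ (point-∈ x (yOf γ)) (sym (yOf-point x (yOf γ))))))
        where γ∈ = proj₂ (s₃∈ _ _ α₀γ)
      block : ∀ y → sumF (λ x → P α₀ (point x y) * W u (point x y)) ≡ sumF (λ t → a t * a (m t))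
      block y = let (x , α₀γ) = S₃.oncePerBlock α₀∈ y in
        trans (cong (λ w → sumF (λ x → P α₀ (point x w) * W u (point x w))) (sym (yOf-point x y))) (block-via α₀γ)

    V-as-⊗ : ∀ β β' → V u β β' ≡ (pathCount col s₂ u ⊗ σ col (s₂ ᵀ)) β β'
    V-as-⊗ β β' = begin
      sumF (λ δ → σ col s₂ β δ * sumF (λ ε → σ col u δ ε * σ col s₂ β' ε))
        ≡⟨ sumF-cong (λ δ → sumF-*ˡ {n} (σ col s₂ β δ) (λ ε → σ col u δ ε * σ col s₂ β' ε)) ⟨
      sumF (λ δ → sumF (λ ε → σ col s₂ β δ * (σ col u δ ε * σ col s₂ β' ε)))
        ≡⟨ sumF-comm {n} {n} (λ δ ε → σ col s₂ β δ * (σ col u δ ε * σ col s₂ β' ε)) ⟩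
      sumF (λ ε → sumF (λ δ → σ col s₂ β δ * (σ col u δ ε * σ col s₂ β' ε)))
        ≡⟨ sumF-cong (λ ε → trans (sumF-cong (λ δ → sym (*-assoc (σ col s₂ β δ) (σ col u δ ε) (σ col s₂ β' ε))))
                                  (sumF-*ʳ {n} (σ col s₂ β' ε) (λ δ → σ col s₂ β δ * σ col u δ ε))) ⟩
      sumF (λ ε → pathCount col s₂ u β ε * σ col s₂ β' ε)
        ≡⟨ sumF-cong (λ ε → cong (pathCount col s₂ u β ε *_) (σᵀ s₂ ε β')) ⟨
      sumF (λ ε → pathCount col s₂ u β ε * σ col (s₂ ᵀ) ε β') ∎
      where open ≡-Reasoning

    V-class : ClassFunction (V u)
    V-class α β γ δ same = trans (V-as-⊗ α β)
      (trans (⊗σ-classFunction (coherent s₂ u) (s₂ ᵀ) α β γ δ same) (sym (V-as-⊗ γ δ)))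

    V-block-sum : ∀ {β} → col β β ≡ j → ∀ y → sumF (λ x → V u β (Ωj.point x y)) ≡ p
    V-block-sum {β} β∈ y = begin
      sumF (λ x → V u β (Ωj.point x y))
        ≡⟨ sumF-pull-inner (σ col s₂ β) (σ col u) (λ x ε → σ col s₂ (Ωj.point x y) ε) ⟩
      sumF (λ δ → σ col s₂ β δ * sumF (λ ε → σ col u δ ε * sumF (λ x → σ col s₂ (Ωj.point x y) ε)))
        ≡⟨ sumF-cong (λ δ → cong (σ col s₂ β δ *_) (sumF-cong (λ ε → σ-*-absorb {u} {δ} {ε} _ (one-in-block δ ε)))) ⟩
      sumF (λ δ → σ col s₂ β δ * outDeg col u δ)
        ≡⟨ sumF-cong (λ δ → σ-*-absorb {s₂} {β} {δ} _ (λ βδ → outDeg≡valency (proj₁ u∈O) (proj₂ u∈O) (proj₂ (s₂∈ _ _ βδ)))) ⟩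
      outDeg col s₂ β
        ≡⟨ outDeg-s₂ β∈ ⟩
      p ∎
      where
      open ≡-Reasoning
      one-in-block : ∀ δ ε → col δ ε ≡ u → sumF (λ x → σ col s₂ (Ωj.point x y) ε) ≡ 1
      one-in-block δ ε δε = trans (sumF-cong (λ x → sym (σᵀ s₂ ε (Ωj.point x y))))
                                  (S₂ᵀ.successorsIn≡1 (proj₂ (InO⇒InFiber u∈O δε)) y)

    V-crossBlock : ∀ {β β'} → col β β ≡ j → col β' β' ≡ j → Ωj.yOf β ≢ Ωj.yOf β' → V u β β' ≡ 1
    V-crossBlock {β} {β'} β∈ β'∈ ββ'-differ = *-cancelˡ-≡ (V u β β') 1 p (begin
      p * V u β β'                                  ≡⟨ sumF-const {p} (V u β β') ⟨
      sumF {p} (λ _ → V u β β')                     ≡⟨ sumF-cong (λ x → V-class β β' β (Ωj.point x (Ωj.yOf β')) (same-colour x)) ⟩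
      sumF (λ x → V u β (Ωj.point x (Ωj.yOf β')))   ≡⟨ V-block-sum β∈ (Ωj.yOf β') ⟩
      p                                             ≡⟨ *-identityʳ p ⟨
      p * 1                                         ∎)
      where
      open ≡-Reasoning
      same-colour : ∀ x → col β β' ≡ col β (Ωj.point x (Ωj.yOf β'))
      same-colour x = Ωj.crossBlock-colour β∈ β'∈ (Ωj.point-∈ _ _) ββ'-differ (sym (Ωj.yOf-point _ _))

    -- Two s₂-successors of β joined by u lie in one block, hence coincide, forcing u = 1.
    V-diagonal-nonidentity : u ≢ k → ∀ β → V u β β ≡ 0
    V-diagonal-nonidentity u≢k β = sumF-zero _ λ δ → σ-*-vanish {s₂} {β} {δ} _ λ βδ → sumF-zero _ λ ε →
      σ-*-vanish {u} {δ} {ε} _ λ δε → ≟ᶜ-≢ λ βε →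
        u≢k (trans (sym (subst (λ w → col δ w ≡ u) (sym (S₂.atMostOncePerBlock βδ βε (InO⇒sameBlock u∈O δε))) δε))
                   (proj₁ (InO⇒InFiber u∈O δε)))

    ΣAV-at-successor : (D : ℕ) → (∀ {β} → col β β ≡ j → V u β β ≡ D) →
      ∀ {β} → col α₀ β ≡ s₁ → sumF (λ β' → A β' * V u β β') ≡ (p + D) ∸ 1
    ΣAV-at-successor D V-diagonal {β} α₀β = trans (sym (m+n∸n≡m _ 1)) (cong (_∸ 1) (begin
      sumF (λ β' → A β' * V u β β') + 1        ≡⟨ cong (sumF (λ β' → A β' * V u β β') +_) (≟ᶜ-≡ α₀β) ⟨
      sumF (λ β' → A β' * V u β β') + A β      ≡⟨ sumF-exchange _ A β (λ β' β'≢β → σ-*-absorb {s₁} {α₀} {β'} _ (other-block β'≢β)) ⟩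
      sumF A + A β * V u β β                   ≡⟨ cong₂ _+_ outDeg-α₀
                                                           (cong₂ _*_ (≟ᶜ-≡ α₀β) (V-diagonal β∈)) ⟩
      p + 1 * D                                ≡⟨ cong (p +_) (*-identityˡ D) ⟩
      p + D                                    ∎))
      where
      open ≡-Reasoning
      β∈ = proj₂ (s₁∈ _ _ α₀β)
      other-block : ∀ {β'} → β' ≢ β → col α₀ β' ≡ s₁ → V u β β' ≡ 1
      other-block β'≢β α₀β' = V-crossBlock β∈ (proj₂ (s₁∈ _ _ α₀β'))
        (λ same → β'≢β (sym (S₁.atMostOncePerBlock α₀β α₀β' same)))

    Σa·a∘m : (m : Fin r → Fin r) → (∀ t → InO k t → IsComp t u (m t)) →
      (D : ℕ) → (∀ {β} → col β β ≡ j → V u β β ≡ D) → sumF (λ t → a t * a (m t)) ≡ (p + D) ∸ 1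
    Σa·a∘m m m-comp D V-diagonal = *-cancelˡ-≡ _ _ p (begin
      p * sumF (λ t → a t * a (m t))                     ≡⟨ ΣPW≡p*Σa·a∘m m m-comp ⟨
      sumF (λ δ → P α₀ δ * W u δ)                        ≡⟨ ΣPW≡ΣAAV u ⟩
      sumF (λ β → A β * sumF (λ β' → A β' * V u β β'))   ≡⟨ sumF-cong (λ β → σ-*-cong {s₁} {α₀} {β} (ΣAV-at-successor D V-diagonal)) ⟩
      sumF (λ β → A β * ((p + D) ∸ 1))                   ≡⟨ sumF-*ʳ ((p + D) ∸ 1) A ⟩
      outDeg col s₁ α₀ * ((p + D) ∸ 1)                   ≡⟨ cong (_* ((p + D) ∸ 1)) outDeg-α₀ ⟩
      p * ((p + D) ∸ 1)                                  ∎)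
      where open ≡-Reasoning

  V-diagonal-identity : ∀ {β} → col β β ≡ j → V k β β ≡ p
  V-diagonal-identity {β} β∈ = trans (sumF-cong (λ δ → σ-*-absorb {s₂} {β} {δ} _ loop-only)) (outDeg-s₂ β∈)
    where
    loop-only : ∀ {δ} → col β δ ≡ s₂ → sumF (λ ε → σ col k δ ε * σ col s₂ β ε) ≡ 1
    loop-only {δ} βδ = trans (sumF-single _ δ (λ ε ε≢δ → cong (_* σ col s₂ β ε)
                                 (≟ᶜ-≢ (λ δε → ε≢δ (sym (diagonal δ δ ε (trans δ∈ (sym δε))))))))
                             (cong₂ _*_ (≟ᶜ-≡ δ∈) (≟ᶜ-≡ βδ))
      where δ∈ = proj₂ (s₂∈ _ _ βδ)

  k∈O : InO k k
  k∈O = subst (InO k) γ₀∈ (sameBlock⇒InO γ₀∈ γ₀∈ refl)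

  compose-identity : ∀ t → InO k t → IsComp t k t
  compose-identity t _ α γ β αγ γβ = subst (λ w → col α w ≡ t) (diagonal γ₀ γ β (trans γ₀∈ (sym γβ))) αγ

  sum-a² : sumF (λ t → a t * a t) ≡ (p + p) ∸ 1
  sum-a² = Thin.Σa·a∘m k∈O (λ t → t) compose-identity p V-diagonal-identity

  sum-a·a∘m : ∀ u → InO k u → u ≢ k → (m : Fin r → Fin r) → (∀ t → InO k t → IsComp t u (m t)) →
    sumF (λ t → a t * a (m t)) ≡ p ∸ 1
  sum-a·a∘m u u∈O u≢k m m-comp =
    trans (Thin.Σa·a∘m u∈O m m-comp 0 (λ {β} _ → Thin.V-diagonal-nonidentity u∈O u≢k β)) (cong (_∸ 1) (+-identityʳ p))

lemma3p6 : (p : ℕ) → Prime p → {n r : ℕ} → (X : CoherentConfiguration n r) →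
    let open CC X in
    (∀ i → IsFiber i → FiberIsoWr X p i) →
    (∀ s i j → IsFiber i → IsFiber j → i ≢ j → InS s i j → Valency s p) →
    (∀ s → (Σ (Fin r) λ i → IsFiber i × InS s i i) ⊎ ¬ Regular s) →
    (i j k : Fin r) → IsFiber i → IsFiber j → IsFiber k →
    i ≢ j → j ≢ k → i ≢ k →
    (s₁ s₂ s₃ : Fin r) → InS s₁ i j → InS s₂ j k → InS s₃ i k →
    Σ (Fin r → ℕ) λ a →
      (∀ t → ¬ InO k t → a t ≡ 0) ×
      (∀ α β → (σ col s₁ ⊗ σ col s₂) α β ≡ (σ col s₃ ⊗ (λ γ δ → sumF (λ t → a t * σ col t γ δ))) α β) ×
      (sumF a ≡ p) ×
      (sumF (λ t → a t * a t) ≡ (p + p) ∸ 1) ×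
      (∀ u → InO k u → u ≢ k → (m : Fin r → Fin r) → (∀ t → InO k t → IsComp t u (m t)) →
        sumF (λ t → a t * a (m t)) ≡ p ∸ 1)
lemma3p6 zero ()
lemma3p6 (suc zero) ()
lemma3p6 (suc (suc q)) p-prime X wreath valency homogeneous-or-irregular i j k i-fiber j-fiber k-fiber i≢j j≢k i≢k
         s₁ s₂ s₃ s₁∈ s₂∈ s₃∈ =
  a , a-outside-O , product-decomposition , sum-a , sum-a² , sum-a·a∘m
  where
  open Triangle q p-prime X wreath valency (Configuration.irregular-off-diagonal X homogeneous-or-irregular)
                i-fiber j-fiber k-fiber i≢j j≢k i≢k s₁∈ s₂∈ s₃∈
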